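{- Let $G$ be a graph containing an induced subgraph isomorphic to $K_{m,n}$ with bipartition classes $A$ (of size $m$) and $B$ (of size $n$). Let $\varphi$ be a cover of $G$ w.r.t. $\mathcal{Ca}$, let $s=\max\{|\varphi^{ -1}(a)|:a\in A\}$, and let $\psi$ be the restriction of $\varphi$ to the subgraph $G'$ of $G$ obtained by removing all edges of this $K_{m,n}$. Then there are at least $n-2sm$ vertices $b\in B$ such that $|\psi^{ -1}(b)|\leq|\varphi^{ -1}(b)|-m$.
   Context: All graphs are finite and simple. A caterpillar is a tree in which the non-leaf vertices form a path (the spline); $\mathcal{Ca}$ is the class of caterpillar forests (disjoint unions of caterpillars). A cover of $G$ w.r.t. $\mathcal{Ca}$ is a graph homomorphism $\varphi$ from a disjoint union $C_1\dot{\cup}\cdots\dot{\cup}C_k$ of caterpillar forests to $G$ which is edge-surjective (every edge of $G$ is the image of some edge); it need not be injective. For a subgraph $H$ of $G$, the restriction of $\varphi$ to $H$ is the map $\psi=\varphi|_{\varphi^{ -1}(H)}$, where $\varphi^{ -1}(H)$ is the subgraph of $C_1\dot{\cup}\cdots\dot{\cup}C_k$ formed by all edges mapped to edges of $H$ together with their end vertices; thus $\psi^{ -1}(v)$ is the set of vertices of this subgraph mapped to $v$. -}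

module Defs where

open import Data.Nat using (ℕ; _≤_; _+_; _⊔_)
open import Data.Fin using (Fin; _≟_)
open import Data.Bool using (Bool; true; false; _∧_; _∨_; not)
open import Data.List using (List; []; _∷_; _++_; length; filterᵇ; allFin; map; foldr)
open import Data.Bool.ListAction using (any)
open import Data.List.Relation.Unary.Linked using (Linked)
open import Data.List.Relation.Unary.Unique.Propositional using (Unique)
open import Data.List.Membership.Propositional using (_∈_)
open import Data.Product using (Σ; _×_; ∃)
open import Relation.Binary.PropositionalEquality using (_≡_; _≢_)
open import Relation.Nullary using (¬_)
open import Relation.Nullary.Decidable using (⌊_⌋)

record Graph (N : ℕ) : Set where
  field
    adj    : Fin N → Fin N → Bool
    sym    : ∀ u v → adj u v ≡ adj v u
    irrefl : ∀ v → adj v v ≡ false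
open Graph public

Edge : ∀ {N} → Graph N → Fin N → Fin N → Set
Edge G u v = adj G u v ≡ true

countᵇ : ∀ n → (Fin n → Bool) → ℕ
countᵇ n p = length (filterᵇ p (allFin n))

anyFin : ∀ n → (Fin n → Bool) → Bool
anyFin n p = any p (allFin n)

deg : ∀ {N} → Graph N → Fin N → ℕ
deg {N} G v = countᵇ N (adj G v)

IsPath : ∀ {N} → Graph N → List (Fin N) → Set
IsPath G xs = Unique xs × Linked (Edge G) xs

data Walk {N} (G : Graph N) : Fin N → Fin N → Set where
  [] : ∀ {v} → Walk G v v
  _∷_ : ∀ {u w v} → Edge G u w → Walk G w v → Walk G u v

Connected : ∀ {N} → Graph N → Fin N → Fin N → Set
Connected G u v = Walk G u v

-- a cycle x, ys..., y (at least 3 distinct vertices) closed by the edge y x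
HasCycle : ∀ {N} → Graph N → Set
HasCycle {N} G =
  Σ (Fin N) λ x → Σ (List (Fin N)) λ ys → Σ (Fin N) λ y →
    Unique (x ∷ ys ++ y ∷ []) × Linked (Edge G) (x ∷ ys ++ y ∷ [])
    × 1 ≤ length ys × Edge G y x

Forest : ∀ {N} → Graph N → Set
Forest G = ¬ HasCycle G

-- caterpillar forest: a forest in which, in every connected component,
-- the non-leaf vertices (degree ≠ 1) form the vertex set of a path (the spine)
CaterpillarForest : ∀ {N} → Graph N → Set
CaterpillarForest {N} G =
  Forest G ×
  (∀ x → Σ (List (Fin N)) λ spine → IsPath G spine ×
     (∀ v → (v ∈ spine → Connected G x v × deg G v ≢ 1)
          × (Connected G x v × deg G v ≢ 1 → v ∈ spine)))

IsHom : ∀ {M N} → Graph M → Graph N → (Fin M → Fin N) → Set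
IsHom H G φ = ∀ x y → Edge H x y → Edge G (φ x) (φ y)

EdgeSurjective : ∀ {M N} → Graph M → Graph N → (Fin M → Fin N) → Set
EdgeSurjective {M} H G φ = ∀ u v → Edge G u v →
  Σ (Fin M) λ x → Σ (Fin M) λ y → Edge H x y × φ x ≡ u × φ y ≡ v

IsCaCover : ∀ {M N} → Graph M → Graph N → (Fin M → Fin N) → Set
IsCaCover H G φ = CaterpillarForest H × IsHom H G φ × EdgeSurjective H G φ

preimageSize : ∀ {M N} → (Fin M → Fin N) → Fin N → ℕ
preimageSize {M} φ v = countᵇ M (λ x → ⌊ φ x ≟ v ⌋)

-- |ψ⁻¹(v)| where ψ is the restriction of φ to the subgraph with
-- adjacency sub: vertices x of H with φ x = v incident to an edge of H
-- mapped to an edge of the subgraph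
restrictedPreimageSize : ∀ {M N} → Graph M → (Fin M → Fin N) →
  (Fin N → Fin N → Bool) → Fin N → ℕ
restrictedPreimageSize {M} H φ sub v =
  countᵇ M (λ x → ⌊ φ x ≟ v ⌋ ∧ anyFin M (λ y → adj H x y ∧ sub (φ x) (φ y)))

InducedKmn : ∀ {N} → Graph N → ∀ m n → (Fin m → Fin N) → (Fin n → Fin N) → Set
InducedKmn G m n A B =
  (∀ i i' → A i ≡ A i' → i ≡ i') × (∀ j j' → B j ≡ B j' → j ≡ j')
  × (∀ i j → A i ≢ B j)
  × (∀ i j → Edge G (A i) (B j))
  × (∀ i i' → adj G (A i) (A i') ≡ false)
  × (∀ j j' → adj G (B j) (B j') ≡ false)

inImage : ∀ {k N} → (Fin k → Fin N) → Fin N → Bool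
inImage {k} f u = anyFin k (λ i → ⌊ f i ≟ u ⌋)

removeKmn : ∀ {m n N} → Graph N → (Fin m → Fin N) → (Fin n → Fin N) →
  Fin N → Fin N → Bool
removeKmn G A B u v =
  adj G u v ∧ not ((inImage A u ∧ inImage B v) ∨ (inImage B u ∧ inImage A v))

-- s = max { |φ⁻¹(a)| : a ∈ A }  (0 if m = 0)
maxPreimage : ∀ {m M N} → (Fin M → Fin N) → (Fin m → Fin N) → ℕ
maxPreimage {m} φ A = foldr _⊔_ 0 (map (λ i → preimageSize φ (A i)) (allFin m))

module Submission where

-- Let X (overA below) be the set of vertices of the caterpillar forest H lying over A;
-- since every a ∈ A has at most s preimages, |X| ≤ m·s.  Call b = B j good
-- if for every a = A i the edge a b is covered by an edge x y of H with
-- φ x = a, φ y = b and y a leaf.  Such a leaf y meets only the removed edge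
-- a b, so y ∉ ψ⁻¹(b); and its unique neighbour determines i.  Hence a good b
-- has m preimages outside ψ⁻¹(b), i.e. |ψ⁻¹(b)| + m ≤ |φ⁻¹(b)|.  If b is
-- bad, some edge a b is covered only by edges x y with y a non-leaf, so y is
-- a non-leaf neighbour of a vertex of X lying over b.  In a caterpillar
-- forest every vertex has at most two non-leaf neighbours (they sit on the
-- spine right next to it), so at most 2|X| ≤ 2sm vertices of B are bad.

open import Defs hiding (sym)
open import Data.Nat using (ℕ; suc; _≤_; _+_; _*_; _∸_; _≤ᵇ_; _⊔_; z≤n; s≤s)
open import Data.Nat.Properties hiding (_≟_)
import Data.Nat as ℕ
open import Data.Bool using (Bool; true; false; _∧_; _∨_; not; T; T?)
open import Data.Bool.Properties using (T-≡; T-∧; T-not-≡; ∨-zeroʳ; ∧-zeroʳ)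
import Data.Bool as Bool
open import Data.Fin using (Fin; _≟_)
import Data.Fin.Properties as Fin
open import Data.List using (List; []; _∷_; _++_; [_]; length; filter; filterᵇ; allFin; map; foldr; concat; take)
open import Data.List.Properties using (length-++; length-map; length-tabulate; length-take; ++-assoc; filter-all)
open import Data.List.Relation.Unary.Any using (here; there; satisfied)
open import Data.List.Relation.Unary.Any.Properties using (any⁺; any⁻)
open import Data.List.Relation.Unary.All as All using ([]; _∷_)
import Data.List.Relation.Unary.All.Properties as All
open import Data.List.Relation.Unary.AllPairs using ([]; _∷_)
open import Data.List.Relation.Unary.Linked as Linked using ([]; [-]; _∷_)
open import Data.List.Relation.Unary.Unique.Propositional using (Unique)
import Data.List.Relation.Unary.Unique.Propositional.Properties as Unique
open import Data.List.Membership.Propositional using (_∈_; lose)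
open import Data.List.Membership.Propositional.Properties
open import Data.Product using (Σ; _×_; _,_; proj₁; proj₂)
open import Data.Sum using (inj₁; inj₂)
open import Data.Empty using (⊥-elim)
open import Function using (_∘_; const)
open import Function.Bundles using (Equivalence)
open import Relation.Binary.PropositionalEquality using (_≡_; _≢_; refl; sym; trans; cong; cong₂; subst; module ≡-Reasoning)
open import Relation.Nullary using (¬_; Dec; yes; no; ¬?)
open import Relation.Nullary.Decidable using (⌊_⌋; _×-dec_; fromWitness)

module _ {a} {X : Set a} where

  length-≤-by-injection : ∀ {b r} {Y : Set b} (R : X → Y → Set r) →
    (∀ {x x' y} → R x y → R x' y → x ≡ x') →
    (xs : List X) (ys : List Y) → Unique xs →
    (∀ {x} → x ∈ xs → Σ Y λ y → y ∈ ys × R x y) → length xs ≤ length ys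
  length-≤-by-injection R inj [] ys _ f = z≤n
  length-≤-by-injection R inj (x ∷ xs) ys (x∉xs ∷ uniq) f
    with f (here refl)
  ... | y , y∈ys , Rxy with ∈-∃++ y∈ys
  ... | ys₁ , ys₂ , refl = begin
    suc (length xs)               ≤⟨ s≤s (length-≤-by-injection R inj xs (ys₁ ++ ys₂) uniq f′) ⟩
    suc (length (ys₁ ++ ys₂))     ≡⟨ cong suc (length-++ ys₁) ⟩
    suc (length ys₁ + length ys₂) ≡⟨ +-suc (length ys₁) (length ys₂) ⟨
    length ys₁ + length (y ∷ ys₂) ≡⟨ length-++ ys₁ ⟨
    length (ys₁ ++ y ∷ ys₂)       ∎
    where
    open ≤-Reasoning
    f′ : ∀ {x′} → x′ ∈ xs → Σ _ λ y′ → y′ ∈ ys₁ ++ ys₂ × R x′ y′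
    f′ x′∈ with f (there x′∈)
    ... | y′ , y′∈ , R′ with ∈-++⁻ ys₁ y′∈
    ... | inj₁ p = y′ , ∈-++⁺ˡ p , R′
    ... | inj₂ (here refl) = ⊥-elim (All.lookup x∉xs x′∈ (sym (inj R′ Rxy)))
    ... | inj₂ (there p) = y′ , ∈-++⁺ʳ ys₁ p , R′

  length-≤-by-⊆ : (xs ys : List X) → Unique xs → (∀ {x} → x ∈ xs → x ∈ ys) →
    length xs ≤ length ys
  length-≤-by-⊆ xs ys uniq sub =
    length-≤-by-injection _≡_ (λ p q → trans p (sym q)) xs ys uniq (λ p → _ , sub p , refl)

  count-split : (p q : X → Bool) (xs : List X) →
    length (filterᵇ p xs)
      ≡ length (filterᵇ (λ x → p x ∧ q x) xs) + length (filterᵇ (λ x → p x ∧ not (q x)) xs)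
  count-split p q [] = refl
  count-split p q (x ∷ xs) with p x | q x
  ... | false | _     = count-split p q xs
  ... | true  | true  = cong suc (count-split p q xs)
  ... | true  | false = trans (cong suc (count-split p q xs)) (sym (+-suc _ _))

  count-complement : (q : X → Bool) (xs : List X) →
    length xs ≡ length (filterᵇ q xs) + length (filterᵇ (not ∘ q) xs)
  count-complement q xs = begin
    length xs                       ≡⟨ cong length (filter-all (T? ∘ const true) (All.universal _ xs)) ⟨
    length (filterᵇ (const true) xs) ≡⟨ count-split (const true) q xs ⟩
    length (filterᵇ q xs) + length (filterᵇ (not ∘ q) xs) ∎
    where open ≡-Reasoning

  length-concat-≤ : (c : ℕ) (xss : List (List X)) →
    (∀ {xs} → xs ∈ xss → length xs ≤ c) → length (concat xss) ≤ length xss * c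
  length-concat-≤ c [] bound = z≤n
  length-concat-≤ c (xs ∷ xss) bound rewrite length-++ xs {concat xss} =
    +-mono-≤ (bound (here refl)) (length-concat-≤ c xss (bound ∘ there))

  ∈-filterᵇ⁺ : (p : X → Bool) {x : X} {xs : List X} → x ∈ xs → T (p x) → x ∈ filterᵇ p xs
  ∈-filterᵇ⁺ p = ∈-filter⁺ (T? ∘ p)

  ∈-filterᵇ⁻ : (p : X → Bool) {x : X} {xs : List X} → x ∈ filterᵇ p xs → T (p x)
  ∈-filterᵇ⁻ p {xs = xs} x∈ = proj₂ (∈-filter⁻ (T? ∘ p) {xs = xs} x∈)

length-allFin : ∀ k → length (allFin k) ≡ k
length-allFin k = length-tabulate {n = k} (λ i → i)

≤-foldr-⊔ : ∀ {x} xs → x ∈ xs → x ≤ foldr _⊔_ 0 xs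
≤-foldr-⊔ (y ∷ xs) (here refl) = m≤m⊔n y _
≤-foldr-⊔ (y ∷ xs) (there x∈) = ≤-trans (≤-foldr-⊔ xs x∈) (m≤n⊔m y _)

inImage-self : ∀ {k N} (f : Fin k → Fin N) i → T (inImage f (f i))
inImage-self f i = any⁺ _ (lose (∈-allFin i) (fromWitness refl))

module _ {N} (H : Graph N) where

  edge-sym : ∀ {u v} → Edge H u v → Edge H v u
  edge-sym {u} {v} e = trans (Graph.sym H v u) e

  edge-≢ : ∀ {u v} → Edge H u v → u ≢ v
  edge-≢ {u} e refl with trans (sym e) (irrefl H u)
  ... | ()

  ∈-neighbours : ∀ {x y} → Edge H x y → y ∈ filterᵇ (adj H x) (allFin N)
  ∈-neighbours {y = y} e = ∈-filterᵇ⁺ _ (∈-allFin y) (Equivalence.from T-≡ e)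

  leaf-neighbour-unique : ∀ {y x x′} → deg H y ≡ 1 → Edge H y x → Edge H y x′ → x ≡ x′
  leaf-neighbour-unique {y} {x} {x′} d e e′ with x ≟ x′
  ... | yes x≡x′ = x≡x′
  ... | no x≢x′ = ⊥-elim (1+n≰n (subst (2 ≤_) d two≤deg))
    where
    two≤deg : 2 ≤ deg H y
    two≤deg = length-≤-by-⊆ (x ∷ x′ ∷ []) _ ((x≢x′ ∷ []) ∷ [] ∷ [])
      λ { (here refl) → ∈-neighbours e ; (there (here refl)) → ∈-neighbours e′ }

  path-prefix : ∀ xs {ys} → IsPath H (xs ++ ys) → IsPath H xs
  path-prefix [] _ = [] , []
  path-prefix (x ∷ []) _ = ([] ∷ []) , [-]
  path-prefix (x ∷ y ∷ xs) ((x∉ ∷ uniq) , (e ∷ linked)) with path-prefix (y ∷ xs) (uniq , linked)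
  ... | uniq′ , linked′ = (All.++⁻ˡ (y ∷ xs) x∉ ∷ uniq′) , (e ∷ linked′)

  path-suffix : ∀ xs {ys} → IsPath H (xs ++ ys) → IsPath H ys
  path-suffix [] p = p
  path-suffix (x ∷ xs) ((_ ∷ uniq) , linked) = path-suffix xs (uniq , Linked.tail linked)

module _ {a} {X : Set a} where

  lastᴸ : List X → List X
  lastᴸ [] = []
  lastᴸ (x ∷ []) = x ∷ []
  lastᴸ (x ∷ y ∷ xs) = lastᴸ (y ∷ xs)

  ∈-lastᴸ : ∀ xs {y} → y ∈ lastᴸ (xs ++ y ∷ [])
  ∈-lastᴸ [] = here refl
  ∈-lastᴸ (x ∷ []) = here refl
  ∈-lastᴸ (x ∷ x′ ∷ xs) = ∈-lastᴸ (x′ ∷ xs)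

  length-lastᴸ : ∀ xs → length (lastᴸ xs) ≤ 1
  length-lastᴸ [] = z≤n
  length-lastᴸ (x ∷ []) = ≤-refl
  length-lastᴸ (x ∷ y ∷ xs) = length-lastᴸ (y ∷ xs)

  -- the (at most two) entries next to the position between L and R
  flanks : List X → List X → List X
  flanks L R = lastᴸ L ++ take 1 R

  length-flanks : ∀ L R → length (flanks L R) ≤ 2
  length-flanks L R rewrite length-++ (lastᴸ L) {take 1 R} | length-take 1 R =
    +-mono-≤ (length-lastᴸ L) (m⊓n≤m 1 (length R))

module _ {N} (H : Graph N) (forest : Forest H) where

  no-chord : ∀ {u q Q w} → IsPath H (u ∷ q ∷ Q) → w ∈ Q → ¬ Edge H w u
  no-chord {u} {q} {w = w} path w∈Q e with ∈-∃++ w∈Q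
  ... | Q₁ , Q₂ , refl = forest (u , q ∷ Q₁ , w , proj₁ cycle , proj₂ cycle , s≤s z≤n , e)
    where
    cycle : IsPath H (u ∷ q ∷ Q₁ ++ w ∷ [])
    cycle = path-prefix H (u ∷ q ∷ Q₁ ++ w ∷ [])
      (subst (IsPath H) (cong (λ z → u ∷ q ∷ z) (sym (++-assoc Q₁ [ w ] Q₂))) path)

  path-neighbour : ∀ L x R {y} → IsPath H (L ++ x ∷ R) → y ∈ L ++ x ∷ R → Edge H x y →
    y ∈ flanks L R
  path-neighbour L x R path y∈ e with ∈-++⁻ L y∈
  ... | inj₂ (here refl) = ⊥-elim (edge-≢ H e refl)
  path-neighbour L x (r ∷ R) path y∈ e | inj₂ (there (here refl)) = ∈-++⁺ʳ (lastᴸ L) (here refl)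
  path-neighbour L x (r ∷ R) path y∈ e | inj₂ (there (there y∈R)) =
    ⊥-elim (no-chord (path-suffix H L path) y∈R (edge-sym H e))
  path-neighbour L x R path y∈ e | inj₁ y∈L with ∈-∃++ y∈L
  ... | L₁ , [] , refl = ∈-++⁺ˡ (∈-lastᴸ L₁)
  ... | L₁ , l ∷ L₂ , refl = ⊥-elim (no-chord tail (∈-++⁺ʳ L₂ (here refl)) e)
    where
    tail : IsPath H (_ ∷ l ∷ L₂ ++ x ∷ R)
    tail = path-suffix H L₁ (subst (IsPath H) (++-assoc L₁ (_ ∷ l ∷ L₂) (x ∷ R)) path)

nonleafNeighbours : ∀ {N} → Graph N → Fin N → List (Fin N)
nonleafNeighbours {N} H x =
  filter (λ y → (adj H x y Bool.≟ true) ×-dec ¬? (deg H y ℕ.≟ 1)) (allFin N)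

-- In a caterpillar forest, x is either a leaf (one neighbour at all) or on
-- the spine, where its non-leaf neighbours are its neighbours on the spine.
nonleafNeighbours-≤2 : ∀ {N} (H : Graph N) → CaterpillarForest H → ∀ x →
  length (nonleafNeighbours H x) ≤ 2
nonleafNeighbours-≤2 {N} H (forest , spineOf) x with deg H x ℕ.≟ 1
... | yes leaf = ≤-trans (length-≤-by-⊆ _ _ unique (∈-neighbours H ∘ edge)) (≤-trans (≤-reflexive leaf) (n≤1+n 1))
  where
  unique : Unique (nonleafNeighbours H x)
  unique = Unique.filter⁺ _ (Unique.allFin⁺ N)
  edge : ∀ {y} → y ∈ nonleafNeighbours H x → Edge H x y
  edge y∈ = proj₁ (proj₂ (∈-filter⁻ _ {xs = allFin N} y∈))
... | no nonleaf with spineOf x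
... | spine , path , onSpine with ∈-∃++ (proj₂ (onSpine x) ([] , nonleaf))
... | L , R , refl = ≤-trans (length-≤-by-⊆ _ (flanks L R) unique flank) (length-flanks L R)
  where
  unique : Unique (nonleafNeighbours H x)
  unique = Unique.filter⁺ _ (Unique.allFin⁺ N)
  flank : ∀ {y} → y ∈ nonleafNeighbours H x → y ∈ flanks L R
  flank {y} y∈ with ∈-filter⁻ _ {xs = allFin N} y∈
  ... | _ , e , y-nonleaf =
    path-neighbour H forest L x R path (proj₂ (onSpine y) ((e ∷ []) , y-nonleaf)) e

-- A, B span the edges of a K_{m,n} in G (only injectivity and the edges are
-- needed), and φ : H → G is edge-surjective from a caterpillar forest H.

module CompleteBipartiteCover {N M} (G : Graph N) {m n} (A : Fin m → Fin N) (B : Fin n → Fin N)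
  (A-injective : ∀ i i′ → A i ≡ A i′ → i ≡ i′) (B-injective : ∀ j j′ → B j ≡ B j′ → j ≡ j′)
  (AB-edge : ∀ i j → Edge G (A i) (B j))
  (H : Graph M) (φ : Fin M → Fin N) (caterpillar : CaterpillarForest H)
  (surjective : EdgeSurjective H G φ) where

  s : ℕ
  s = maxPreimage φ A


  fibre : Fin N → List (Fin M)
  fibre v = filterᵇ (λ x → ⌊ φ x ≟ v ⌋) (allFin M)

  overA : List (Fin M)
  overA = filter (λ x → Fin.any? λ i → φ x ≟ A i) (allFin M)

  nonleafOverA : List (Fin M)
  nonleafOverA = concat (map (nonleafNeighbours H) overA)

  -- |overA| ≤ m·s: overA lies in the union of the fibres over A.
  overA-length : length overA ≤ m * s
  overA-length = begin
    length overA                  ≤⟨ length-≤-by-⊆ _ _ (Unique.filter⁺ _ (Unique.allFin⁺ M)) in-fibres ⟩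
    length (concat fibresOverA)   ≤⟨ length-concat-≤ s fibresOverA fibre-bound ⟩
    length fibresOverA * s        ≡⟨ cong (_* s) (trans (length-map _ (allFin m)) (length-allFin m)) ⟩
    m * s                         ∎
    where
    open ≤-Reasoning
    fibresOverA = map (fibre ∘ A) (allFin m)
    in-fibres : ∀ {x} → x ∈ overA → x ∈ concat fibresOverA
    in-fibres {x} x∈ with proj₂ (∈-filter⁻ _ {xs = allFin M} x∈)
    ... | i , φx≡Ai =
      ∈-concat⁺′ (∈-filterᵇ⁺ _ (∈-allFin x) (fromWitness φx≡Ai)) (∈-map⁺ (fibre ∘ A) (∈-allFin i))
    fibre-bound : ∀ {xs} → xs ∈ fibresOverA → length xs ≤ s
    fibre-bound xs∈ with ∈-map⁻ (fibre ∘ A) xs∈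
    ... | i , _ , refl = ≤-foldr-⊔ _ (∈-map⁺ (λ i → preimageSize φ (A i)) (∈-allFin i))

  -- Each vertex contributes at most two non-leaf neighbours.
  nonleafOverA-length : length nonleafOverA ≤ 2 * s * m
  nonleafOverA-length = begin
    length nonleafOverA                        ≤⟨ length-concat-≤ 2 _ two-each ⟩
    length (map (nonleafNeighbours H) overA) * 2 ≡⟨ cong (_* 2) (length-map _ overA) ⟩
    length overA * 2                           ≤⟨ *-monoˡ-≤ 2 overA-length ⟩
    m * s * 2                                  ≡⟨ reorder ⟩
    2 * s * m                                  ∎
    where
    open ≤-Reasoning
    two-each : ∀ {xs} → xs ∈ map (nonleafNeighbours H) overA → length xs ≤ 2
    two-each xs∈ with ∈-map⁻ (nonleafNeighbours H) xs∈
    ... | x , _ , refl = nonleafNeighbours-≤2 H caterpillar x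
    reorder : m * s * 2 ≡ 2 * s * m
    reorder = trans (*-comm (m * s) 2) (trans (cong (2 *_) (*-comm m s)) (sym (*-assoc 2 s m)))

  LeafCovered : Fin m → Fin n → Set
  LeafCovered i j = Σ (Fin M) λ y → deg H y ≡ 1 ×
    Σ (Fin M) λ x → Edge H x y × φ x ≡ A i × φ y ≡ B j

  leafCovered? : ∀ i j → Dec (LeafCovered i j)
  leafCovered? i j = Fin.any? λ y → (deg H y ℕ.≟ 1) ×-dec Fin.any? λ x →
    (adj H x y Bool.≟ true) ×-dec (φ x ≟ A i) ×-dec (φ y ≟ B j)

  -- whether x belongs to ψ⁻¹(φ x), i.e. meets an edge over an edge of G'
  restricted : Fin M → Bool
  restricted x = anyFin M (λ z → adj H x z ∧ removeKmn G A B (φ x) (φ z))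

  loses : Fin n → Bool
  loses j = restrictedPreimageSize H φ (removeKmn G A B) (B j) + m ≤ᵇ preimageSize φ (B j)

  removed : ∀ i j → removeKmn G A B (B j) (A i) ≡ false
  removed i j = begin
    adj G (B j) (A i) ∧ not (other ∨ (inImage B (B j) ∧ inImage A (A i)))
      ≡⟨ cong (λ b → adj G (B j) (A i) ∧ not (other ∨ b))
              (cong₂ _∧_ (Equivalence.to T-≡ (inImage-self B j)) (Equivalence.to T-≡ (inImage-self A i))) ⟩
    adj G (B j) (A i) ∧ not (other ∨ true) ≡⟨ cong (λ b → adj G (B j) (A i) ∧ not b) (∨-zeroʳ other) ⟩
    adj G (B j) (A i) ∧ false             ≡⟨ ∧-zeroʳ _ ⟩
    false                                 ∎
    where
    open ≡-Reasoning
    other = inImage A (B j) ∧ inImage B (A i)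

  leaf-not-restricted : ∀ {i j x y} → deg H y ≡ 1 → Edge H x y → φ x ≡ A i → φ y ≡ B j →
    ¬ T (restricted y)
  leaf-not-restricted {i} {j} {x} {y} leaf e φx φy t
    with satisfied (any⁻ _ (allFin M) t)
  ... | z , t′ with Equivalence.to T-∧ t′
  ... | yz , kept with leaf-neighbour-unique H leaf (Equivalence.to T-≡ yz) (edge-sym H e)
  ... | refl rewrite φx | φy | removed i j = kept

  good-loses : ∀ j → (∀ i → LeafCovered i j) → T (loses j)
  good-loses j covered = ≤⇒≤ᵇ (begin
    restrictedPreimageSize H φ (removeKmn G A B) (B j) + m ≤⟨ +-monoʳ-≤ _ m≤lost ⟩
    restrictedPreimageSize H φ (removeKmn G A B) (B j) + length lost
      ≡⟨ count-split (λ x → ⌊ φ x ≟ B j ⌋) restricted (allFin M) ⟨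
    preimageSize φ (B j)                                   ∎)
    where
    open ≤-Reasoning
    lost = filterᵇ (λ x → ⌊ φ x ≟ B j ⌋ ∧ not (restricted x)) (allFin M)
    HangsAt : Fin m → Fin M → Set
    HangsAt i y = Σ (Fin M) λ x → Edge H x y × φ x ≡ A i × deg H y ≡ 1
    hangs-injective : ∀ {i i′ y} → HangsAt i y → HangsAt i′ y → i ≡ i′
    hangs-injective (x , e , φx , leaf) (x′ , e′ , φx′ , _) = A-injective _ _
      (trans (sym φx) (trans (cong φ (leaf-neighbour-unique H leaf (edge-sym H e) (edge-sym H e′))) φx′))
    leaf-lost : ∀ {i} → i ∈ allFin m → Σ (Fin M) λ y → y ∈ lost × HangsAt i y
    leaf-lost {i} _ with covered i
    ... | y , leaf , x , e , φx , φy =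
      y , ∈-filterᵇ⁺ _ (∈-allFin y)
            (Equivalence.from T-∧ (fromWitness φy , Equivalence.from T-not-≡ not-restricted))
        , (x , e , φx , leaf)
      where
      not-restricted : restricted y ≡ false
      not-restricted with restricted y in eq
      ... | false = refl
      ... | true = ⊥-elim (leaf-not-restricted leaf e φx φy (Equivalence.from T-≡ eq))
    m≤lost : m ≤ length lost
    m≤lost = subst (_≤ length lost) (length-allFin m)
      (length-≤-by-injection HangsAt hangs-injective (allFin m) lost (Unique.allFin⁺ m) leaf-lost)

  bad-witness : ∀ j → ¬ T (loses j) → Σ (Fin M) λ y → y ∈ nonleafOverA × φ y ≡ B j
  bad-witness j not-loses
    with Fin.¬∀⟶∃¬ m (λ i → LeafCovered i j) (λ i → leafCovered? i j) (not-loses ∘ good-loses j)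
  ... | i , uncovered with surjective (A i) (B j) (AB-edge i j)
  ... | x , y , e , φx , φy = y , ∈-concat⁺′ y∈ (∈-map⁺ (nonleafNeighbours H) x∈) , φy
    where
    y∈ : y ∈ nonleafNeighbours H x
    y∈ = ∈-filter⁺ _ (∈-allFin y) (e , λ leaf → uncovered (y , leaf , x , e , φx , φy))
    x∈ : x ∈ overA
    x∈ = ∈-filter⁺ _ (∈-allFin x) (i , φx)

  bad : List (Fin n)
  bad = filterᵇ (not ∘ loses) (allFin n)

  -- Distinct bad vertices have distinct witnesses, so there are few of them.
  bad-length : length bad ≤ 2 * s * m
  bad-length = ≤-trans (length-≤-by-injection (λ j y → φ y ≡ B j)
                          (λ p q → B-injective _ _ (trans (sym p) q))
                          bad nonleafOverA (Unique.filter⁺ _ (Unique.allFin⁺ n)) witness)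
                       nonleafOverA-length
    where
    witness : ∀ {j} → j ∈ bad → Σ (Fin M) λ y → y ∈ nonleafOverA × φ y ≡ B j
    witness {j} j∈ = bad-witness j λ t →
      subst T (Equivalence.to T-not-≡ (∈-filterᵇ⁻ (not ∘ loses) {xs = allFin n} j∈)) t

lemma11 : ∀ {N M} (G : Graph N) (m n : ℕ) (A : Fin m → Fin N) (B : Fin n → Fin N)
    → InducedKmn G m n A B
    → (H : Graph M) (φ : Fin M → Fin N) → IsCaCover H G φ
    → n ∸ 2 * maxPreimage φ A * m
    ≤ countᵇ n (λ j → restrictedPreimageSize H φ (removeKmn G A B) (B j) + m
    ≤ᵇ preimageSize φ (B j))
lemma11 G m n A B (A-inj , B-inj , _ , AB-edge , _ , _) H φ (caterpillar , _ , surjective) = begin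
  n ∸ 2 * s * m                 ≤⟨ ∸-monoʳ-≤ n bad-length ⟩
  n ∸ length bad
    ≡⟨ cong (_∸ length bad) (trans (sym (length-allFin n)) (count-complement loses (allFin n))) ⟩
  countᵇ n loses + length bad ∸ length bad ≡⟨ m+n∸n≡m (countᵇ n loses) (length bad) ⟩
  countᵇ n loses                ∎
  where
  open ≤-Reasoning
  open CompleteBipartiteCover G A B A-inj B-inj AB-edge H φ caterpillar surjective
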